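{- For every $k\ge1$, every permutation belonging to the basis of $B_k^{(td)}$ has length at most $3k+1$.
   Context: Permutations are written in one-line notation; $S_n$ is the set of permutations of length $n$. A block transposition of $\sigma=\sigma_1\cdots\sigma_m$ with indices $1\le p<q<r\le m+1$ produces $\sigma_1\cdots\sigma_{p-1}\,\sigma_q\cdots\sigma_{r-1}\,\sigma_p\cdots\sigma_{q-1}\,\sigma_r\cdots\sigma_m$. The block transposition distance $td(\sigma)$ is the minimum number of block transpositions needed to transform $\sigma$ into the identity permutation of the same length. $B_k^{(td)}=\bigcup_{n\ge0}\{\sigma\in S_n : td(\sigma)\le k\}$; it is a permutation class, i.e. closed downward under the pattern order (where $\sigma$ is contained in $\tau$ if some subsequence of $\tau$ is order-isomorphic to $\sigma$). The basis of a permutation class is the set of permutations not in the class that are minimal in the pattern order among permutations not in the class. -}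

module Defs where

open import Data.Nat using (ℕ; zero; suc; _<_)
open import Data.List using (List; []; _∷_; _++_; length; upTo; lookup)
open import Data.List.Relation.Binary.Permutation.Propositional using (_↭_)
open import Data.Fin using (Fin)
open import Data.Product using (Σ; ∃; _×_)
open import Function.Bundles using (_⇔_)
open import Relation.Binary.PropositionalEquality using (_≡_; _≢_)
open import Relation.Nullary using (¬_)

-- A permutation of length n in one-line notation, with values 0,1,…,n-1
-- (0-based convention; identity of length n is upTo n = 0 ∷ 1 ∷ … ∷ n-1).
IsPerm : List ℕ → Set
IsPerm σ = σ ↭ upTo (length σ)

-- σ ⟶ τ : τ is obtained from σ by one block transposition.
-- With indices p<q<r: σ = A ++ B ++ C ++ D, B = σ_p…σ_{q-1} (nonempty),
-- C = σ_q…σ_{r-1} (nonempty); result A ++ C ++ B ++ D.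
record BlockTransp (σ τ : List ℕ) : Set where
  constructor bt
  field
    A B C D : List ℕ
    B≢[]    : B ≢ []
    C≢[]    : C ≢ []
    σ≡      : σ ≡ A ++ B ++ C ++ D
    τ≡      : τ ≡ A ++ C ++ B ++ D

data TdAtMost : ℕ → List ℕ → Set where
  done : ∀ {k σ} → σ ≡ upTo (length σ) → TdAtMost k σ
  step : ∀ {k σ τ} → BlockTransp σ τ → TdAtMost k τ → TdAtMost (suc k) σ

InB : ℕ → List ℕ → Set
InB k σ = IsPerm σ × TdAtMost k σ

_≼_ : List ℕ → List ℕ → Set
σ ≼ τ = Σ (Fin (length σ) → Fin (length τ)) λ f →
          (∀ i j → i Data.Fin.< j → f i Data.Fin.< f j) ×
          (∀ i j → (lookup σ i < lookup σ j) ⇔ (lookup τ (f i) < lookup τ (f j)))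

InBasis : ℕ → List ℕ → Set
InBasis k σ = IsPerm σ × ¬ TdAtMost k σ ×
              (∀ τ → IsPerm τ → τ ≼ σ → τ ≢ σ → TdAtMost k τ)

-- Frame σ ∈ Sₙ as 0 , σ₁ + 1 , … , σₙ + 1 , n + 1 and count its adjacencies, the
-- consecutive entries u , u + 1. The identity has n + 1 of them and a block
-- transposition creates at most three, so td σ ≤ k forces n + 1 ≤ #adj σ + 3k.
-- A basis element σ has no adjacency: deleting one end of an adjacency leaves a
-- proper pattern, which is in the class, and re-inflating the deleted entry turns its
-- sorting sequence into one for σ. Deleting an entry x of an adjacency-free σ creates
-- at most one adjacency, where its neighbours meet, and at most one bridge x - 1 , x + 1;
-- among the first three entries there is always one whose deletion creates only one
-- of the two. The resulting pattern τ has length n - 1, td τ ≤ k and #adj τ ≤ 1,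
-- hence n ≤ 3k + 1.

module Submission where

open import Defs
open import Relation.Binary.PropositionalEquality hiding ([_])
open import Data.Nat using (ℕ; zero; suc; pred; _≤_; _<_; _+_; _*_; _∸_; z≤n; s≤s; s≤s⁻¹)
open import Data.Nat.Properties
open import Data.Nat.Tactic.RingSolver using (solve-∀)
open import Data.List using (List; []; _∷_; _++_; [_]; _∷ʳ_; length; map; upTo; lookup; concatMap)
import Data.List.Properties as List
open import Data.List.Relation.Unary.All as All using (All; []; _∷_)
import Data.List.Relation.Unary.All.Properties as All
import Data.List.Relation.Unary.AllPairs as AllPairs
open import Data.List.Relation.Unary.Unique.Propositional using (Unique; _∷_)
import Data.List.Relation.Unary.Unique.Propositional.Properties as Unique
open import Data.List.Relation.Binary.Permutation.Propositional using (_↭_; ↭-sym; ↭⇒↭ₛ)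
open import Data.List.Relation.Binary.Permutation.Propositional.Properties
  using (All-resp-↭; shift; drop-mid; ↭-length; ∷↭∷ʳ) renaming (map⁺ to ↭-map⁺)
open import Data.List.Relation.Binary.Permutation.Setoid.Properties (setoid ℕ) using (Unique-resp-↭)
open import Data.List.Membership.Propositional.Properties using (∈-upTo⁻; ∈-lookup)
open import Data.Fin as Fin using (Fin; cast)
open import Data.Fin.Properties using (toℕ-cast)
open import Data.Product using (Σ-syntax; ∃; _×_; _,_; proj₁; proj₂)
open import Data.Sum using (_⊎_; inj₁; inj₂)
open import Function using (_∘_)
open import Function.Bundles using (_⇔_; mk⇔; Equivalence)
import Function.Properties.Equivalence as ⇔
open import Relation.Nullary using (Dec; yes; no; ¬_; contradiction)
open import Relation.Nullary.Decidable using (_×-dec_)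
open import Relation.Binary.Definitions using (tri<; tri≈; tri>)

indicator : {P : Set} → Dec P → ℕ
indicator (yes _) = 1
indicator (no _)  = 0

indicator≤1 : {P : Set} (d : Dec P) → indicator d ≤ 1
indicator≤1 (yes _) = s≤s z≤n
indicator≤1 (no _)  = z≤n

indicator-yes : {P : Set} → P → (d : Dec P) → indicator d ≡ 1
indicator-yes p (yes _) = refl
indicator-yes p (no ¬p) = contradiction p ¬p

indicator-no : {P : Set} → ¬ P → (d : Dec P) → indicator d ≡ 0
indicator-no ¬p (yes p) = contradiction p ¬p
indicator-no ¬p (no _)  = refl

adjacencies : ℕ → List ℕ → ℕ
adjacencies a []      = 0
adjacencies a (b ∷ l) = indicator (b ≟ suc a) + adjacencies b l

lastOr : ℕ → List ℕ → ℕ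
lastOr a []      = a
lastOr a (b ∷ l) = lastOr b l

adjacencies-++ : ∀ a xs ys → adjacencies a (xs ++ ys) ≡ adjacencies a xs + adjacencies (lastOr a xs) ys
adjacencies-++ a []       ys = refl
adjacencies-++ a (b ∷ xs) ys rewrite adjacencies-++ b xs ys = sym (+-assoc (indicator (b ≟ suc a)) _ _)

innerAdjacencies : List ℕ → ℕ
innerAdjacencies []      = 0
innerAdjacencies (b ∷ l) = adjacencies b l

innerAdjacencies≤adjacencies : ∀ a l → innerAdjacencies l ≤ adjacencies a l
innerAdjacencies≤adjacencies a []      = z≤n
innerAdjacencies≤adjacencies a (b ∷ l) = m≤n+m (adjacencies b l) (indicator (b ≟ suc a))

adjacencies≤1+innerAdjacencies : ∀ a l → adjacencies a l ≤ 1 + innerAdjacencies l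
adjacencies≤1+innerAdjacencies a []      = z≤n
adjacencies≤1+innerAdjacencies a (b ∷ l) = +-monoˡ-≤ (adjacencies b l) (indicator≤1 (b ≟ suc a))

-- Swapping B and C only touches the three pairs entering B, C and D.
adjacencies-swapBlocks : ∀ a A B C D →
  adjacencies a (A ++ C ++ B ++ D) ≤ adjacencies a (A ++ B ++ C ++ D) + 3
adjacencies-swapBlocks a A B C D
  rewrite adjacencies-++ a A (C ++ B ++ D) | adjacencies-++ a A (B ++ C ++ D)
        | adjacencies-++ (lastOr a A) C (B ++ D) | adjacencies-++ (lastOr (lastOr a A) C) B D
        | adjacencies-++ (lastOr a A) B (C ++ D) | adjacencies-++ (lastOr (lastOr a A) B) C D
  = begin
      α + (adjacencies l C + (adjacencies _ B + adjacencies _ D))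
        ≤⟨ +-monoʳ-≤ α (+-mono-≤ (adjacencies≤1+innerAdjacencies l C)
                         (+-mono-≤ (adjacencies≤1+innerAdjacencies _ B) (adjacencies≤1+innerAdjacencies _ D))) ⟩
      α + ((1 + iC) + ((1 + iB) + (1 + iD)))
        ≡⟨ rearrange α iB iC iD ⟩
      α + (iB + (iC + iD)) + 3
        ≤⟨ +-monoˡ-≤ 3 (+-monoʳ-≤ α (+-mono-≤ (innerAdjacencies≤adjacencies l B)
                         (+-mono-≤ (innerAdjacencies≤adjacencies _ C) (innerAdjacencies≤adjacencies _ D)))) ⟩
      α + (adjacencies l B + (adjacencies _ C + adjacencies _ D)) + 3 ∎
  where
  open ≤-Reasoning
  α = adjacencies a A
  l = lastOr a A
  iB = innerAdjacencies B
  iC = innerAdjacencies C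
  iD = innerAdjacencies D
  rearrange : ∀ α b c d → α + ((1 + c) + ((1 + b) + (1 + d))) ≡ α + (b + (c + d)) + 3
  rearrange = solve-∀

-- The leading sentinel 0 is supplied as the starting point of `adjacencies 0`.
frame : List ℕ → List ℕ
frame σ = map suc σ ++ [ suc (length σ) ]

#adj : List ℕ → ℕ
#adj σ = adjacencies 0 (frame σ)

length-swapBlocks : ∀ (A B C D : List ℕ) → length (A ++ C ++ B ++ D) ≡ length (A ++ B ++ C ++ D)
length-swapBlocks A B C D
  rewrite List.length-++ A {C ++ B ++ D} | List.length-++ A {B ++ C ++ D}
        | List.length-++ C {B ++ D} | List.length-++ B {C ++ D}
        | List.length-++ B {D} | List.length-++ C {D}
  = cong (length A +_) (+-comm-middle (length B) (length C) (length D))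
  where
  +-comm-middle : ∀ b c d → c + (b + d) ≡ b + (c + d)
  +-comm-middle = solve-∀

length-blockTransp : ∀ {σ τ} → BlockTransp σ τ → length τ ≡ length σ
length-blockTransp (bt A B C D _ _ refl refl) = length-swapBlocks A B C D

map-++-blocks : ∀ (f : ℕ → ℕ) A B C D E →
  map f (A ++ B ++ C ++ D) ++ E ≡ map f A ++ map f B ++ map f C ++ (map f D ++ E)
map-++-blocks f A B C D E = begin
  map f (A ++ B ++ C ++ D) ++ E                  ≡⟨ cong (_++ E) (List.map-++ f A (B ++ C ++ D)) ⟩
  (map f A ++ map f (B ++ C ++ D)) ++ E          ≡⟨ cong (λ w → (map f A ++ w) ++ E) (List.map-++ f B (C ++ D)) ⟩
  (map f A ++ map f B ++ map f (C ++ D)) ++ E    ≡⟨ cong (λ w → (map f A ++ map f B ++ w) ++ E) (List.map-++ f C D) ⟩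
  (map f A ++ map f B ++ map f C ++ map f D) ++ E ≡⟨ List.++-assoc (map f A) _ E ⟩
  map f A ++ (map f B ++ map f C ++ map f D) ++ E ≡⟨ cong (map f A ++_) (List.++-assoc (map f B) _ E) ⟩
  map f A ++ map f B ++ (map f C ++ map f D) ++ E ≡⟨ cong (λ w → map f A ++ map f B ++ w) (List.++-assoc (map f C) _ E) ⟩
  map f A ++ map f B ++ map f C ++ (map f D ++ E) ∎
  where open ≡-Reasoning

#adj-blockTransp : ∀ {σ τ} → BlockTransp σ τ → #adj τ ≤ #adj σ + 3
#adj-blockTransp (bt A B C D _ _ refl refl)
  rewrite length-swapBlocks A B C D
        | map-++-blocks suc A C B D [ suc (length (A ++ B ++ C ++ D)) ]
        | map-++-blocks suc A B C D [ suc (length (A ++ B ++ C ++ D)) ]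
  = adjacencies-swapBlocks 0 (map suc A) (map suc B) (map suc C) _

range : ℕ → ℕ → List ℕ
range a zero    = []
range a (suc m) = a ∷ range (suc a) m

range-++ : ∀ a m k → range a (m + k) ≡ range a m ++ range (a + m) k
range-++ a zero    k rewrite +-identityʳ a = refl
range-++ a (suc m) k rewrite range-++ (suc a) m k | +-suc a m = refl

map-suc-range : ∀ a m → map suc (range a m) ≡ range (suc a) m
map-suc-range a zero    = refl
map-suc-range a (suc m) = cong (suc a ∷_) (map-suc-range (suc a) m)

range-∷ʳ : ∀ a m → range a m ++ [ a + m ] ≡ range a (suc m)
range-∷ʳ a m = trans (sym (range-++ a m 1)) (cong (range a) (+-comm m 1))

upTo≡range : ∀ m → upTo m ≡ range 0 m
upTo≡range zero    = refl
upTo≡range (suc m) = begin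
  upTo (suc m)         ≡⟨ List.upTo-∷ʳ m ⟨
  upTo m ++ [ m ]      ≡⟨ cong (_++ [ m ]) (upTo≡range m) ⟩
  range 0 m ++ [ m ]   ≡⟨ range-∷ʳ 0 m ⟩
  range 0 (suc m)      ∎
  where open ≡-Reasoning

adjacencies-range : ∀ a m → adjacencies a (range (suc a) m) ≡ m
adjacencies-range a zero    = refl
adjacencies-range a (suc m) rewrite indicator-yes refl (suc a ≟ suc a) = cong suc (adjacencies-range (suc a) m)

frame-upTo : ∀ m → frame (upTo m) ≡ range 1 (suc m)
frame-upTo m = begin
  map suc (upTo m) ++ [ suc (length (upTo m)) ]
    ≡⟨ cong₂ (λ xs n → map suc xs ++ [ suc n ]) (upTo≡range m) (List.length-upTo m) ⟩
  map suc (range 0 m) ++ [ suc m ]              ≡⟨ cong (_++ [ suc m ]) (map-suc-range 0 m) ⟩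
  range 1 m ++ [ 1 + m ]                        ≡⟨ range-∷ʳ 1 m ⟩
  range 1 (suc m)                               ∎
  where open ≡-Reasoning

#adj-upTo : ∀ m → #adj (upTo m) ≡ suc m
#adj-upTo m rewrite frame-upTo m = adjacencies-range 0 (suc m)

td-lowerBound : ∀ {k σ} → TdAtMost k σ → suc (length σ) ≤ #adj σ + 3 * k
td-lowerBound {k} {σ} (done σ≡id) = begin
  suc (length σ)           ≡⟨ #adj-upTo (length σ) ⟨
  #adj (upTo (length σ))   ≡⟨ cong #adj σ≡id ⟨
  #adj σ                   ≤⟨ m≤m+n (#adj σ) (3 * k) ⟩
  #adj σ + 3 * k           ∎
  where open ≤-Reasoning
td-lowerBound {suc k} {σ} (step {τ = τ} b td) = begin
  suc (length σ)        ≡⟨ cong suc (length-blockTransp b) ⟨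
  suc (length τ)        ≤⟨ td-lowerBound td ⟩
  #adj τ + 3 * k        ≤⟨ +-monoˡ-≤ (3 * k) (#adj-blockTransp b) ⟩
  #adj σ + 3 + 3 * k    ≡⟨ regroup (#adj σ) k ⟩
  #adj σ + 3 * suc k    ∎
  where
  open ≤-Reasoning
  regroup : ∀ a k → a + 3 + 3 * k ≡ a + 3 * suc k
  regroup = solve-∀

-- Standardisation after deleting the value x: the values above x move down by one.
squeeze : ℕ → ℕ → ℕ
squeeze zero    y       = pred y
squeeze (suc x) zero    = zero
squeeze (suc x) (suc y) = suc (squeeze x y)

squeeze-< : ∀ {x y} → y < x → squeeze x y ≡ y
squeeze-< {suc x} {zero}  _         = refl
squeeze-< {suc x} {suc y} (s≤s y<x) = cong suc (squeeze-< y<x)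

squeeze-> : ∀ {x y} → x < y → squeeze x y ≡ pred y
squeeze-> {zero}  {suc y}       _         = refl
squeeze-> {suc x} {suc (suc y)} (s≤s x<y) = cong suc (squeeze-> x<y)

squeeze-<⇔ : ∀ x {y z} → x ≢ y → x ≢ z → (y < z ⇔ squeeze x y < squeeze x z)
squeeze-<⇔ zero    {zero}  {z}     x≢y x≢z = contradiction refl x≢y
squeeze-<⇔ zero    {suc y} {zero}  x≢y x≢z = contradiction refl x≢z
squeeze-<⇔ zero    {suc y} {suc z} x≢y x≢z = mk⇔ s≤s⁻¹ s≤s
squeeze-<⇔ (suc x) {zero}  {zero}  x≢y x≢z = mk⇔ (λ ()) (λ ())
squeeze-<⇔ (suc x) {zero}  {suc z} x≢y x≢z = mk⇔ (λ _ → s≤s z≤n) (λ _ → s≤s z≤n)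
squeeze-<⇔ (suc x) {suc y} {zero}  x≢y x≢z = mk⇔ (λ ()) (λ ())
squeeze-<⇔ (suc x) {suc y} {suc z} x≢y x≢z =
  mk⇔ (λ y<z → s≤s (Equivalence.to IH (s≤s⁻¹ y<z))) (λ y<z → s≤s (Equivalence.from IH (s≤s⁻¹ y<z)))
  where IH = squeeze-<⇔ x (λ e → x≢y (cong suc e)) (λ e → x≢z (cong suc e))

squeeze≡0 : ∀ X {b} → X ≢ b → squeeze X b ≡ 0 → b ≡ 0 ⊎ (X ≡ 0 × b ≡ 1)
squeeze≡0 zero    {zero}     X≢b _ = contradiction refl X≢b
squeeze≡0 zero    {suc zero} X≢b _ = inj₂ (refl , refl)
squeeze≡0 (suc X) {zero}     X≢b _ = inj₁ refl

squeeze-adjacent : ∀ X {a b} → X ≢ a → X ≢ b → squeeze X b ≡ suc (squeeze X a) →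
  b ≡ suc a ⊎ (suc a ≡ X × b ≡ suc X)
squeeze-adjacent zero    {zero}  {b}     X≢a X≢b _  = contradiction refl X≢a
squeeze-adjacent zero    {suc a} {zero}  X≢a X≢b _  = contradiction refl X≢b
squeeze-adjacent zero    {suc a} {suc b} X≢a X≢b eq = inj₁ (cong suc eq)
squeeze-adjacent (suc X) {zero}  {suc b} X≢a X≢b eq with squeeze≡0 X (X≢b ∘ cong suc) (suc-injective eq)
... | inj₁ refl         = inj₁ refl
... | inj₂ (refl , refl) = inj₂ (refl , refl)
squeeze-adjacent (suc X) {suc a} {suc b} X≢a X≢b eq
  with squeeze-adjacent X (X≢a ∘ cong suc) (X≢b ∘ cong suc) (suc-injective eq)
... | inj₁ b≡1+a           = inj₁ (cong suc b≡1+a)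
... | inj₂ (1+a≡X , b≡1+X) = inj₂ (cong suc 1+a≡X , cong suc b≡1+X)

map-squeeze-below : ∀ x a m → a + m ≤ x → map (squeeze x) (range a m) ≡ range a m
map-squeeze-below x a zero    _ = refl
map-squeeze-below x a (suc m) a+m<x rewrite +-suc a m =
  cong₂ _∷_ (squeeze-< (<-≤-trans (s≤s (m≤m+n a m)) a+m<x)) (map-squeeze-below x (suc a) m a+m<x)

map-squeeze-above : ∀ x a m → x < a → map (squeeze x) (range a m) ≡ range (pred a) m
map-squeeze-above x a       zero    _   = refl
map-squeeze-above x (suc a) (suc m) x<a =
  cong₂ _∷_ (squeeze-> x<a) (map-squeeze-above x (suc (suc a)) m (m<n⇒m<1+n x<a))

upTo-split : ∀ {x n} → x < n → upTo n ≡ range 0 x ++ x ∷ range (suc x) (n ∸ suc x)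
upTo-split {x} {n} x<n = begin
  upTo n                              ≡⟨ upTo≡range n ⟩
  range 0 n                           ≡⟨ cong (range 0) (m+[n∸m]≡n (<⇒≤ x<n)) ⟨
  range 0 (x + (n ∸ x))               ≡⟨ range-++ 0 x (n ∸ x) ⟩
  range 0 x ++ range x (n ∸ x)        ≡⟨ cong (λ m → range 0 x ++ range x m) (+-∸-assoc 1 x<n) ⟩
  range 0 x ++ x ∷ range (suc x) (n ∸ suc x) ∎
  where open ≡-Reasoning

isPerm⇒unique : ∀ {σ} → IsPerm σ → Unique σ
isPerm⇒unique p = Unique-resp-↭ (↭⇒↭ₛ (↭-sym p)) (Unique.upTo⁺ _)

isPerm⇒bounded : ∀ {σ} → IsPerm σ → All (_< length σ) σ
isPerm⇒bounded p = All-resp-↭ (↭-sym p) (All.tabulate ∈-upTo⁻)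

All-delete : ∀ {P : ℕ → Set} L {x} R → All P (L ++ x ∷ R) → P x × All P (L ++ R)
All-delete L {x} R ps with All-resp-↭ (shift x L R) ps
... | px ∷ ps′ = px , ps′

Unique-delete : ∀ L {x} R → Unique (L ++ x ∷ R) → All (x ≢_) (L ++ R) × Unique (L ++ R)
Unique-delete L {x} R u with Unique-resp-↭ (↭⇒↭ₛ (shift x L R)) u
... | x≢ ∷ u′ = x≢ , u′

delete : List ℕ → ℕ → List ℕ → List ℕ
delete L x R = map (squeeze x) (L ++ R)

length-delete : ∀ L x R → length (L ++ x ∷ R) ≡ suc (length (delete L x R))
length-delete L x R = trans (↭-length (shift x L R)) (cong suc (sym (List.length-map (squeeze x) (L ++ R))))

delete-isPerm : ∀ L x R → IsPerm (L ++ x ∷ R) → IsPerm (delete L x R)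
delete-isPerm L x R p = subst (delete L x R ↭_) (cong upTo (sym length≡)) mapped
  where
  n = length (L ++ x ∷ R)
  x<n : x < n
  x<n = proj₁ (All-delete L R (isPerm⇒bounded p))
  k = n ∸ suc x
  remaining : L ++ R ↭ range 0 x ++ range (suc x) k
  remaining = drop-mid L (range 0 x) (subst (L ++ x ∷ R ↭_) (upTo-split x<n) p)
  squeezed : map (squeeze x) (range 0 x ++ range (suc x) k) ≡ upTo (x + k)
  squeezed = begin
    map (squeeze x) (range 0 x ++ range (suc x) k)               ≡⟨ List.map-++ (squeeze x) (range 0 x) _ ⟩
    map (squeeze x) (range 0 x) ++ map (squeeze x) (range (suc x) k)
      ≡⟨ cong₂ _++_ (map-squeeze-below x 0 x ≤-refl) (map-squeeze-above x (suc x) k ≤-refl) ⟩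
    range 0 x ++ range x k                                       ≡⟨ range-++ 0 x k ⟨
    range 0 (x + k)                                              ≡⟨ upTo≡range (x + k) ⟨
    upTo (x + k)                                                 ∎
    where open ≡-Reasoning
  mapped : delete L x R ↭ upTo (x + k)
  mapped = subst (delete L x R ↭_) squeezed (↭-map⁺ (squeeze x) remaining)
  length≡ : length (delete L x R) ≡ x + k
  length≡ = trans (↭-length mapped) (List.length-upTo (x + k))

lookup-map : ∀ (g : ℕ → ℕ) xs i → lookup (map g xs) i ≡ g (lookup xs (cast (List.length-map g xs) i))
lookup-map g (a ∷ xs) Fin.zero    = refl
lookup-map g (a ∷ xs) (Fin.suc i) = lookup-map g xs i

skipIndex : ∀ L (x : ℕ) R → Fin (length (L ++ R)) → Fin (length (L ++ x ∷ R))
skipIndex []      x R i           = Fin.suc i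
skipIndex (a ∷ L) x R Fin.zero    = Fin.zero
skipIndex (a ∷ L) x R (Fin.suc i) = Fin.suc (skipIndex L x R i)

lookup-skipIndex : ∀ L x R i → lookup (L ++ x ∷ R) (skipIndex L x R i) ≡ lookup (L ++ R) i
lookup-skipIndex []      x R i           = refl
lookup-skipIndex (a ∷ L) x R Fin.zero    = refl
lookup-skipIndex (a ∷ L) x R (Fin.suc i) = lookup-skipIndex L x R i

skipIndex-mono : ∀ L x R {i j} → i Fin.< j → skipIndex L x R i Fin.< skipIndex L x R j
skipIndex-mono []      x R i<j                               = s≤s i<j
skipIndex-mono (a ∷ L) x R {Fin.zero}  {Fin.suc j} _         = s≤s z≤n
skipIndex-mono (a ∷ L) x R {Fin.suc i} {Fin.suc j} (s≤s i<j) = s≤s (skipIndex-mono L x R i<j)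

delete-≼ : ∀ L x R → All (x ≢_) (L ++ R) → delete L x R ≼ (L ++ x ∷ R)
delete-≼ L x R x∉ = position , position-mono , orderIso
  where
  unmap : Fin (length (delete L x R)) → Fin (length (L ++ R))
  unmap = cast (List.length-map (squeeze x) (L ++ R))
  position : Fin (length (delete L x R)) → Fin (length (L ++ x ∷ R))
  position i = skipIndex L x R (unmap i)
  position-mono : ∀ i j → i Fin.< j → position i Fin.< position j
  position-mono i j i<j = skipIndex-mono L x R (subst₂ _<_ (sym (toℕ-cast _ i)) (sym (toℕ-cast _ j)) i<j)
  entry : ∀ i → lookup (L ++ x ∷ R) (position i) ≡ lookup (L ++ R) (unmap i)
  entry i = lookup-skipIndex L x R (unmap i)
  x≢entry : ∀ i → x ≢ lookup (L ++ R) (unmap i)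
  x≢entry i = All.lookup x∉ (∈-lookup (unmap i))
  orderIso : ∀ i j → (lookup (delete L x R) i < lookup (delete L x R) j) ⇔
                     (lookup (L ++ x ∷ R) (position i) < lookup (L ++ x ∷ R) (position j))
  orderIso i j rewrite lookup-map (squeeze x) (L ++ R) i | lookup-map (squeeze x) (L ++ R) j
                     | entry i | entry j
    = ⇔.sym (squeeze-<⇔ x (x≢entry i) (x≢entry j))

basis-delete : ∀ {k} L x R → InBasis k (L ++ x ∷ R) → TdAtMost k (delete L x R)
basis-delete L x R (isPerm , _ , proper) =
  proper (delete L x R) (delete-isPerm L x R isPerm) (delete-≼ L x R x∉) shorter
  where
  x∉ = proj₁ (Unique-delete L R (isPerm⇒unique isPerm))
  shorter : delete L x R ≢ L ++ x ∷ R
  shorter eq = 1+n≢n (sym (trans (cong length eq) (length-delete L x R)))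

IsIdentity : List ℕ → Set
IsIdentity σ = σ ≡ upTo (length σ)

≡upTo⇒IsIdentity : ∀ {xs} m → xs ≡ upTo m → IsIdentity xs
≡upTo⇒IsIdentity m refl = cong upTo (sym (List.length-upTo m))

inflate : List ℕ → (ℕ → List ℕ) → List ℕ → List ℕ → List ℕ
inflate P g S τ = P ++ concatMap g τ ++ S

NonEmptyBlocks : (ℕ → List ℕ) → Set
NonEmptyBlocks g = ∀ z → g z ≢ []

concatMap-nonEmpty : ∀ {g} → NonEmptyBlocks g → ∀ {B} → B ≢ [] → concatMap g B ≢ []
concatMap-nonEmpty nonEmpty {[]}    B≢[] _  = B≢[] refl
concatMap-nonEmpty nonEmpty {b ∷ B} _    eq = nonEmpty b (List.++-conicalˡ _ _ eq)

inflate-blocks : ∀ P S g (A B C D : List ℕ) →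
  inflate P g S (A ++ B ++ C ++ D) ≡ (P ++ concatMap g A) ++ concatMap g B ++ concatMap g C ++ (concatMap g D ++ S)
inflate-blocks P S g A B C D = begin
  P ++ concatMap g (A ++ B ++ C ++ D) ++ S
    ≡⟨ cong (λ w → P ++ w ++ S) (List.concatMap-++ g A (B ++ C ++ D)) ⟩
  P ++ (cA ++ concatMap g (B ++ C ++ D)) ++ S
    ≡⟨ cong (λ w → P ++ (cA ++ w) ++ S) (List.concatMap-++ g B (C ++ D)) ⟩
  P ++ (cA ++ cB ++ concatMap g (C ++ D)) ++ S
    ≡⟨ cong (λ w → P ++ (cA ++ cB ++ w) ++ S) (List.concatMap-++ g C D) ⟩
  P ++ (cA ++ cB ++ cC ++ cD) ++ S
    ≡⟨ cong (P ++_) (List.++-assoc cA _ S) ⟩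
  P ++ cA ++ (cB ++ cC ++ cD) ++ S
    ≡⟨ cong (λ w → P ++ cA ++ w) (List.++-assoc cB _ S) ⟩
  P ++ cA ++ cB ++ (cC ++ cD) ++ S
    ≡⟨ cong (λ w → P ++ cA ++ cB ++ w) (List.++-assoc cC cD S) ⟩
  P ++ cA ++ cB ++ cC ++ cD ++ S
    ≡⟨ List.++-assoc P cA _ ⟨
  (P ++ cA) ++ cB ++ cC ++ cD ++ S ∎
  where
  open ≡-Reasoning
  cA = concatMap g A
  cB = concatMap g B
  cC = concatMap g C
  cD = concatMap g D

inflate-blockTransp : ∀ P S {g} → NonEmptyBlocks g → ∀ {τ τ′} →
  BlockTransp τ τ′ → BlockTransp (inflate P g S τ) (inflate P g S τ′)
inflate-blockTransp P S {g} nonEmpty (bt A B C D B≢[] C≢[] refl refl) =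
  bt (P ++ concatMap g A) (concatMap g B) (concatMap g C) (concatMap g D ++ S)
     (concatMap-nonEmpty nonEmpty B≢[]) (concatMap-nonEmpty nonEmpty C≢[])
     (inflate-blocks P S g A B C D) (inflate-blocks P S g A C B D)

inflate-TdAtMost : ∀ P S {g} → NonEmptyBlocks g → ∀ {n} → IsIdentity (inflate P g S (upTo n)) →
  ∀ {k τ} → TdAtMost k τ → length τ ≡ n → TdAtMost k (inflate P g S τ)
inflate-TdAtMost P S nonEmpty inflatedId (done τ≡id) refl =
  done (subst (IsIdentity ∘ inflate P _ S) (sym τ≡id) inflatedId)
inflate-TdAtMost P S nonEmpty inflatedId (step b td) length≡ =
  step (inflate-blockTransp P S nonEmpty b)
       (inflate-TdAtMost P S nonEmpty inflatedId td (trans (length-blockTransp b) length≡))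

basis-inflatedDeletion : ∀ {k} L x R P S {g} → InBasis k (L ++ x ∷ R) → NonEmptyBlocks g →
  IsIdentity (inflate P g S (upTo (length (delete L x R)))) →
  inflate P g S (delete L x R) ≢ L ++ x ∷ R
basis-inflatedDeletion L x R P S b nonEmpty inflatedId eq =
  proj₁ (proj₂ b) (subst (TdAtMost _) eq
    (inflate-TdAtMost P S nonEmpty inflatedId (basis-delete L x R b) refl))

-- expand y undoes squeeze (suc y) and doubles y into y , y + 1.
expand : ℕ → ℕ → List ℕ
expand zero    zero    = 0 ∷ 1 ∷ []
expand zero    (suc z) = [ suc (suc z) ]
expand (suc y) zero    = [ 0 ]
expand (suc y) (suc z) = map suc (expand y z)

expand-< : ∀ {y z} → z < y → expand y z ≡ [ z ]
expand-< {suc y} {zero}  _         = refl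
expand-< {suc y} {suc z} (s≤s z<y) rewrite expand-< z<y = refl

expand-≡ : ∀ y → expand y y ≡ y ∷ suc y ∷ []
expand-≡ zero    = refl
expand-≡ (suc y) rewrite expand-≡ y = refl

expand-> : ∀ {y z} → y < z → expand y z ≡ [ suc z ]
expand-> {zero}  {suc z} _         = refl
expand-> {suc y} {suc z} (s≤s y<z) rewrite expand-> y<z = refl

∷≢[] : ∀ {w : ℕ} {ws} → _≢_ {A = List ℕ} (w ∷ ws) []
∷≢[] ()

expand-nonEmpty : ∀ y → NonEmptyBlocks (expand y)
expand-nonEmpty y z eq with <-cmp z y
... | tri< z<y _ _  = ∷≢[] (trans (sym (expand-< z<y)) eq)
... | tri≈ _ refl _ = ∷≢[] (trans (sym (expand-≡ y)) eq)
... | tri> _ _ y<z  = ∷≢[] (trans (sym (expand-> y<z)) eq)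

concatMap-∷ʳ : ∀ (g : ℕ → List ℕ) xs x → concatMap g (xs ++ [ x ]) ≡ concatMap g xs ++ g x
concatMap-∷ʳ g xs x = trans (List.concatMap-++ g xs [ x ]) (cong (concatMap g xs ++_) (List.++-identityʳ (g x)))

concatMap-expand-below : ∀ {y m} → m ≤ y → concatMap (expand y) (upTo m) ≡ upTo m
concatMap-expand-below {y} {zero}  _   = refl
concatMap-expand-below {y} {suc m} m<y = begin
  concatMap (expand y) (upTo (suc m))          ≡⟨ cong (concatMap (expand y)) (List.upTo-∷ʳ m) ⟨
  concatMap (expand y) (upTo m ++ [ m ])       ≡⟨ concatMap-∷ʳ (expand y) (upTo m) m ⟩
  concatMap (expand y) (upTo m) ++ expand y m  ≡⟨ cong₂ _++_ (concatMap-expand-below (<⇒≤ m<y)) (expand-< m<y) ⟩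
  upTo m ++ [ m ]                              ≡⟨ List.upTo-∷ʳ m ⟩
  upTo (suc m)                                 ∎
  where open ≡-Reasoning

concatMap-expand-upTo : ∀ {y n} → y < n → concatMap (expand y) (upTo n) ≡ upTo (suc n)
concatMap-expand-upTo {y} {suc m} y<1+m = begin
  concatMap (expand y) (upTo (suc m))          ≡⟨ cong (concatMap (expand y)) (List.upTo-∷ʳ m) ⟨
  concatMap (expand y) (upTo m ++ [ m ])       ≡⟨ concatMap-∷ʳ (expand y) (upTo m) m ⟩
  concatMap (expand y) (upTo m) ++ expand y m  ≡⟨ lastBlock (m≤n⇒m<n∨m≡n (s≤s⁻¹ y<1+m)) ⟩
  upTo (suc m) ++ [ suc m ]                    ≡⟨ List.upTo-∷ʳ (suc m) ⟩
  upTo (suc (suc m))                           ∎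
  where
  open ≡-Reasoning
  lastBlock : y < m ⊎ y ≡ m → concatMap (expand y) (upTo m) ++ expand y m ≡ upTo (suc m) ++ [ suc m ]
  lastBlock (inj₁ y<m)  = cong₂ _++_ (concatMap-expand-upTo y<m) (expand-> y<m)
  lastBlock (inj₂ refl) = begin
    concatMap (expand y) (upTo y) ++ expand y y  ≡⟨ cong₂ _++_ (concatMap-expand-below ≤-refl) (expand-≡ y) ⟩
    upTo y ++ [ y ] ++ [ suc y ]                 ≡⟨ List.++-assoc (upTo y) [ y ] [ suc y ] ⟨
    (upTo y ++ [ y ]) ++ [ suc y ]               ≡⟨ cong (_++ [ suc y ]) (List.upTo-∷ʳ y) ⟩
    upTo (suc y) ++ [ suc y ]                    ∎

expand-squeeze : ∀ {y z} → y ≢ z → suc y ≢ z → expand y (squeeze (suc y) z) ≡ [ z ]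
expand-squeeze {y} {z} y≢z 1+y≢z with <-cmp z y
... | tri< z<y _ _ = trans (cong (expand y) (squeeze-< (m<n⇒m<1+n z<y))) (expand-< z<y)
... | tri≈ _ z≡y _ = contradiction (sym z≡y) y≢z
expand-squeeze {y} {suc z} y≢z 1+y≢z | tri> _ _ y<1+z =
  trans (cong (expand y) (squeeze-> 1+y<1+z)) (expand-> (s≤s⁻¹ 1+y<1+z))
  where 1+y<1+z = ≤∧≢⇒< y<1+z 1+y≢z

concatMap-singletons : ∀ {g : ℕ → List ℕ} {l} → All (λ z → g z ≡ [ z ]) l → concatMap g l ≡ l
concatMap-singletons []         = refl
concatMap-singletons (gz≡ ∷ gl) = cong₂ _++_ gz≡ (concatMap-singletons gl)

concatMap-expand-squeeze : ∀ y L R → All (y ≢_) (L ++ R) → All (suc y ≢_) (L ++ R) →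
  concatMap (expand y ∘ squeeze (suc y)) (L ++ y ∷ R) ≡ L ++ y ∷ suc y ∷ R
concatMap-expand-squeeze y L R y∉ 1+y∉ = begin
  concatMap h (L ++ y ∷ R)                   ≡⟨ List.concatMap-++ h L (y ∷ R) ⟩
  concatMap h L ++ h y ++ concatMap h R
    ≡⟨ cong₂ (λ l r → l ++ h y ++ r) (concatMap-singletons (All.++⁻ˡ L fixed))
                                      (concatMap-singletons (All.++⁻ʳ L fixed)) ⟩
  L ++ h y ++ R
    ≡⟨ cong (λ w → L ++ w ++ R) (trans (cong (expand y) (squeeze-< (n<1+n y))) (expand-≡ y)) ⟩
  L ++ y ∷ suc y ∷ R                         ∎
  where
  open ≡-Reasoning
  h = expand y ∘ squeeze (suc y)
  fixed : All (λ z → h z ≡ [ z ]) (L ++ R)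
  fixed = All.zipWith (λ (y≢z , 1+y≢z) → expand-squeeze y≢z 1+y≢z) (y∉ , 1+y∉)

basis-noLeadingZero : ∀ {k} t → ¬ InBasis k (0 ∷ t)
basis-noLeadingZero t b = basis-inflatedDeletion [] 0 t [ 0 ] [] b (λ _ ()) inflatedId inflated≡
  where
  g = [_] ∘ suc
  concatMap-g : ∀ l → concatMap g l ≡ map suc l
  concatMap-g l = trans (sym (List.concatMap-map [_] suc l)) (List.concatMap-pure (map suc l))
  inflatedId : IsIdentity (inflate [ 0 ] g [] (upTo (length (delete [] 0 t))))
  inflatedId = ≡upTo⇒IsIdentity (suc (length (delete [] 0 t)))
    (cong (0 ∷_) (trans (List.++-identityʳ _) (trans (concatMap-g _) (List.map-upTo suc _))))
  0∉t : All (0 ≢_) t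
  0∉t = proj₁ (Unique-delete [] t (isPerm⇒unique (proj₁ b)))
  suc∘pred : ∀ {z} → 0 ≢ z → suc (pred z) ≡ z
  suc∘pred {zero}  0≢0 = contradiction refl 0≢0
  suc∘pred {suc z} _   = refl
  inflated≡ : inflate [ 0 ] g [] (delete [] 0 t) ≡ 0 ∷ t
  inflated≡ = cong (0 ∷_) (begin
    concatMap g (map pred t) ++ []   ≡⟨ List.++-identityʳ _ ⟩
    concatMap g (map pred t)         ≡⟨ concatMap-g (map pred t) ⟩
    map suc (map pred t)             ≡⟨ List.map-∘ t ⟨
    map (suc ∘ pred) t               ≡⟨ List.map-id-local (All.map suc∘pred 0∉t) ⟩
    t                                ∎)
    where open ≡-Reasoning

basis-noTrailingMax : ∀ {k} L y → length (L ++ [ y ]) ≡ suc y → ¬ InBasis k (L ++ [ y ])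
basis-noTrailingMax L y length≡ b =
  basis-inflatedDeletion L y [] [] [ y ] b (λ _ ()) inflatedId inflated≡
  where
  length-delete≡y : length (delete L y []) ≡ y
  length-delete≡y = suc-injective (trans (sym (length-delete L y [])) length≡)
  inflatedId : IsIdentity (inflate [] [_] [ y ] (upTo (length (delete L y []))))
  inflatedId rewrite length-delete≡y =
    ≡upTo⇒IsIdentity (suc y) (trans (cong (_++ [ y ]) (List.concatMap-pure (upTo y))) (List.upTo-∷ʳ y))
  below : All (_< y) L
  below = All.zipWith (λ (z<1+y , y≢z) → ≤∧≢⇒< (s≤s⁻¹ z<1+y) (y≢z ∘ sym))
    (All.++⁻ˡ L (subst (λ n → All (_< n) (L ++ [ y ])) length≡ (isPerm⇒bounded (proj₁ b))) ,
     All.++⁻ˡ L (proj₁ (Unique-delete L [] (isPerm⇒unique (proj₁ b)))))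
  inflated≡ : inflate [] [_] [ y ] (delete L y []) ≡ L ++ [ y ]
  inflated≡ = cong (_++ [ y ]) (begin
    concatMap [_] (delete L y [])    ≡⟨ List.concatMap-pure _ ⟩
    map (squeeze y) (L ++ [])        ≡⟨ cong (map (squeeze y)) (List.++-identityʳ L) ⟩
    map (squeeze y) L                ≡⟨ List.map-id-local (All.map squeeze-< below) ⟩
    L                                ∎)
    where open ≡-Reasoning

basis-noInnerAdjacency : ∀ {k} L y R → ¬ InBasis k (L ++ y ∷ suc y ∷ R)
basis-noInnerAdjacency L y R b =
  basis-inflatedDeletion (L ++ [ y ]) (suc y) R [] [] b′ (expand-nonEmpty y) inflatedId inflated≡
  where
  regroup : (L ++ [ y ]) ++ suc y ∷ R ≡ L ++ y ∷ suc y ∷ R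
  regroup = List.++-assoc L [ y ] (suc y ∷ R)
  b′ = subst (InBasis _) (sym regroup) b
  y<length : y < length (delete (L ++ [ y ]) (suc y) R)
  y<length = s≤s⁻¹ (subst (suc y <_) (length-delete (L ++ [ y ]) (suc y) R)
    (proj₁ (All-delete (L ++ [ y ]) R (isPerm⇒bounded (proj₁ b′)))))
  inflatedId : IsIdentity (inflate [] (expand y) [] (upTo (length (delete (L ++ [ y ]) (suc y) R))))
  inflatedId = ≡upTo⇒IsIdentity _ (trans (List.++-identityʳ _) (concatMap-expand-upTo y<length))
  distinct = Unique-delete L (suc y ∷ R) (isPerm⇒unique (proj₁ b))
  y∉ : All (y ≢_) (L ++ R)
  y∉ = proj₂ (All-delete L R (proj₁ distinct))
  1+y∉ : All (suc y ≢_) (L ++ R)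
  1+y∉ = proj₁ (Unique-delete L R (proj₂ distinct))
  inflated≡ : inflate [] (expand y) [] (delete (L ++ [ y ]) (suc y) R) ≡ (L ++ [ y ]) ++ suc y ∷ R
  inflated≡ = begin
    concatMap (expand y) (map (squeeze (suc y)) ((L ++ [ y ]) ++ R)) ++ []
      ≡⟨ List.++-identityʳ _ ⟩
    concatMap (expand y) (map (squeeze (suc y)) ((L ++ [ y ]) ++ R))
      ≡⟨ List.concatMap-map (expand y) (squeeze (suc y)) ((L ++ [ y ]) ++ R) ⟩
    concatMap (expand y ∘ squeeze (suc y)) ((L ++ [ y ]) ++ R)
      ≡⟨ cong (concatMap _) (List.++-assoc L [ y ] R) ⟩
    concatMap (expand y ∘ squeeze (suc y)) (L ++ y ∷ R)
      ≡⟨ concatMap-expand-squeeze y L R y∉ 1+y∉ ⟩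
    L ++ y ∷ suc y ∷ R
      ≡⟨ regroup ⟨
    (L ++ [ y ]) ++ suc y ∷ R ∎
    where open ≡-Reasoning

-- The places where a ∷ map suc l ++ [ e ] can have an adjacency.
data AdjacencyIn (a : ℕ) : List ℕ → ℕ → Set where
  sentinels : ∀ {e} → e ≡ suc a → AdjacencyIn a [] e
  first     : ∀ {t e} → AdjacencyIn a (a ∷ t) e
  inner     : ∀ L y R {e} → AdjacencyIn a (L ++ y ∷ suc y ∷ R) e
  last      : ∀ L y {e} → e ≡ suc (suc y) → AdjacencyIn a (L ++ [ y ]) e

locateAdjacency : ∀ a l e → adjacencies a (map suc l ++ [ e ]) ≢ 0 → AdjacencyIn a l e
locateAdjacency a [] e nonzero with e ≟ suc a
... | yes e≡ = sentinels e≡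
... | no _   = contradiction refl nonzero
locateAdjacency a (h ∷ t) e nonzero with suc h ≟ suc a
... | yes refl = first
... | no _ with locateAdjacency (suc h) t e nonzero
...   | sentinels e≡ = last [] h e≡
...   | first        = inner [] h _
...   | inner L y R  = inner (h ∷ L) y R
...   | last L y e≡  = last (h ∷ L) y e≡

basis-adjacencyFree : ∀ {k} σ → InBasis k σ → #adj σ ≡ 0
basis-adjacencyFree σ b with #adj σ ≟ 0
... | yes free = free
... | no nonzero with locateAdjacency 0 σ _ nonzero
...   | sentinels _    = contradiction (done refl) (proj₁ (proj₂ b))
...   | first {t}      = contradiction b (basis-noLeadingZero t)
...   | inner L y R    = contradiction b (basis-noInnerAdjacency L y R)
...   | last L y e≡    = contradiction b (basis-noTrailingMax L y (suc-injective e≡))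

-- Consecutive pairs X - 1 , X + 1 in a ∷ l; they become adjacent once X is deleted.
bridges : ℕ → ℕ → List ℕ → ℕ
bridges X a []      = 0
bridges X a (b ∷ l) = indicator ((suc a ≟ X) ×-dec (b ≟ suc X)) + bridges X b l

adjacency-squeeze : ∀ X {a b} → X ≢ a → X ≢ b →
  indicator (squeeze X b ≟ suc (squeeze X a)) ≤ indicator (b ≟ suc a) + indicator ((suc a ≟ X) ×-dec (b ≟ suc X))
adjacency-squeeze X {a} {b} X≢a X≢b with squeeze X b ≟ suc (squeeze X a)
... | no _   = z≤n
... | yes eq with squeeze-adjacent X X≢a X≢b eq
...   | inj₁ adjacent rewrite indicator-yes adjacent (b ≟ suc a) = s≤s z≤n
...   | inj₂ bridge   rewrite indicator-yes bridge ((suc a ≟ X) ×-dec (b ≟ suc X)) = m≤n+m 1 _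

adjacencies-squeeze : ∀ X a W → All (X ≢_) (a ∷ W) →
  adjacencies (squeeze X a) (map (squeeze X) W) ≤ adjacencies a W + bridges X a W
adjacencies-squeeze X a []      _                 = z≤n
adjacencies-squeeze X a (b ∷ W) (X≢a ∷ X≢b ∷ X∉) = begin
  indicator (squeeze X b ≟ suc (squeeze X a)) + adjacencies (squeeze X b) (map (squeeze X) W)
    ≤⟨ +-mono-≤ (adjacency-squeeze X X≢a X≢b) (adjacencies-squeeze X b W (X≢b ∷ X∉)) ⟩
  (indicator (b ≟ suc a) + indicator ((suc a ≟ X) ×-dec (b ≟ suc X))) + (adjacencies b W + bridges X b W)
    ≡⟨ +-comm-middle (indicator (b ≟ suc a)) _ _ _ ⟩
  (indicator (b ≟ suc a) + adjacencies b W) + (indicator ((suc a ≟ X) ×-dec (b ≟ suc X)) + bridges X b W) ∎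
  where
  open ≤-Reasoning
  +-comm-middle : ∀ i j k l → (i + j) + (k + l) ≡ (i + k) + (j + l)
  +-comm-middle = solve-∀

bridges≡0 : ∀ X a W → All (λ c → suc c ≢ X) (a ∷ W) → bridges X a W ≡ 0
bridges≡0 X a []      _                 = refl
bridges≡0 X a (b ∷ W) (1+a≢X ∷ 1+W≢X)
  rewrite indicator-no (1+a≢X ∘ proj₁) ((suc a ≟ X) ×-dec (b ≟ suc X)) = bridges≡0 X b W 1+W≢X

-- Only X - 1 can start a bridge, and it occurs at most once.
bridges≤1 : ∀ X a W → Unique (a ∷ W) → bridges X a W ≤ 1
bridges≤1 X a []      _            = z≤n
bridges≤1 X a (b ∷ W) (a∉ ∷ distinct) with suc a ≟ X
... | no _     = bridges≤1 X b W distinct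
... | yes refl rewrite bridges≡0 (suc a) b W (All.map (λ a≢c 1+c≡1+a → a≢c (sym (suc-injective 1+c≡1+a))) a∉)
  = ≤-trans (≤-reflexive (+-identityʳ _)) (indicator≤1 _)

-- The frame of L ++ x ∷ R with x removed but the other values not relabelled.
deletionFrame : List ℕ → ℕ → List ℕ → List ℕ
deletionFrame L x R = map suc (L ++ R) ++ [ suc (length (L ++ x ∷ R)) ]

deletionCost : List ℕ → ℕ → List ℕ → ℕ
deletionCost L x R = adjacencies 0 (deletionFrame L x R) + bridges (suc x) 0 (deletionFrame L x R)

deletionFrame-unique : ∀ L x R → IsPerm (L ++ x ∷ R) → Unique (0 ∷ deletionFrame L x R)
deletionFrame-unique L x R p =
  subst (Unique ∘ (0 ∷_)) (List.map-++ suc (L ++ R) [ n ])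
    (All.map⁺ (All.universal (λ _ ()) ((L ++ R) ∷ʳ n)) ∷ Unique.map⁺ suc-injective withMax)
  where
  n = length (L ++ x ∷ R)
  rest = Unique-delete L R (isPerm⇒unique p)
  n∉ : All (n ≢_) (L ++ R)
  n∉ = All.map (λ z<n n≡z → <-irrefl (sym n≡z) z<n) (proj₂ (All-delete L R (isPerm⇒bounded p)))
  withMax : Unique ((L ++ R) ∷ʳ n)
  withMax = Unique-resp-↭ (↭⇒↭ₛ (∷↭∷ʳ n (L ++ R))) (n∉ ∷ proj₂ rest)

frame-delete : ∀ L x R → x < length (L ++ x ∷ R) →
  frame (delete L x R) ≡ map (squeeze (suc x)) (deletionFrame L x R)
frame-delete L x R x<n = begin
  map suc (map (squeeze x) (L ++ R)) ++ [ suc (length (delete L x R)) ]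
    ≡⟨ cong₂ (λ l m → l ++ [ m ]) (List.map-∘ (L ++ R)) (trans (squeeze-> (s≤s x<n)) (length-delete L x R)) ⟨
  map (squeeze (suc x) ∘ suc) (L ++ R) ++ [ squeeze (suc x) (suc (length (L ++ x ∷ R))) ]
    ≡⟨ cong (_++ [ squeeze (suc x) (suc (length (L ++ x ∷ R))) ]) (List.map-∘ (L ++ R)) ⟩
  map (squeeze (suc x)) (map suc (L ++ R)) ++ map (squeeze (suc x)) [ suc (length (L ++ x ∷ R)) ]
    ≡⟨ List.map-++ (squeeze (suc x)) (map suc (L ++ R)) _ ⟨
  map (squeeze (suc x)) (deletionFrame L x R) ∎
  where open ≡-Reasoning

#adj-delete : ∀ L x R → IsPerm (L ++ x ∷ R) → #adj (delete L x R) ≤ deletionCost L x R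
#adj-delete L x R p =
  subst (_≤ deletionCost L x R) (cong (adjacencies 0) (sym (frame-delete L x R x<n)))
    (adjacencies-squeeze (suc x) 0 (deletionFrame L x R) ((λ ()) ∷ x∉frame))
  where
  x<n = proj₁ (All-delete L R (isPerm⇒bounded p))
  x∉frame : All (suc x ≢_) (deletionFrame L x R)
  x∉frame = All.++⁺ (All.map⁺ (All.map (_∘ suc-injective) (proj₁ (Unique-delete L R (isPerm⇒unique p)))))
                    ((λ 1+x≡1+n → <-irrefl (suc-injective 1+x≡1+n) x<n) ∷ [])

basis-length≤ : ∀ {k} L x R → InBasis k (L ++ x ∷ R) → deletionCost L x R ≤ 1 →
  length (L ++ x ∷ R) ≤ 3 * k + 1
basis-length≤ {k} L x R b cost≤1 = begin
  length (L ++ x ∷ R)           ≡⟨ length-delete L x R ⟩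
  suc (length (delete L x R))   ≤⟨ td-lowerBound (basis-delete L x R b) ⟩
  #adj (delete L x R) + 3 * k   ≤⟨ +-monoˡ-≤ (3 * k) (≤-trans (#adj-delete L x R (proj₁ b)) cost≤1) ⟩
  1 + 3 * k                     ≡⟨ +-comm 1 (3 * k) ⟩
  3 * k + 1                     ∎
  where open ≤-Reasoning

adjacencies-head : ∀ {a b} l → adjacencies a l ≢ 0 → adjacencies b l ≡ 0 → ∃ λ t → l ≡ suc a ∷ t
adjacencies-head {a} {b} []      nonzero _  = contradiction refl nonzero
adjacencies-head {a} {b} (h ∷ t) nonzero none with h ≟ suc a
... | yes refl = t , refl
... | no _     = contradiction (m+n≡0⇒n≡0 (indicator (h ≟ suc b)) none) nonzero

frameTail-head : ∀ {a e t} rest → map suc rest ++ [ e ] ≡ suc a ∷ t → e ≢ suc a →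
  ∃ λ rest′ → rest ≡ a ∷ rest′
frameTail-head []          refl e≢1+a = contradiction refl e≢1+a
frameTail-head (r ∷ rest′) eq   _     = rest′ , cong (_∷ rest′) (suc-injective (List.∷-injectiveˡ eq))

deletionCost-noAdjacency : ∀ L x R → IsPerm (L ++ x ∷ R) →
  adjacencies 0 (deletionFrame L x R) ≡ 0 → deletionCost L x R ≤ 1
deletionCost-noAdjacency L x R p noAdjacency rewrite noAdjacency =
  bridges≤1 (suc x) 0 (deletionFrame L x R) (deletionFrame-unique L x R p)

-- Deleting 0 from x₁ , 0 , x₁ + 1 , … joins x₁ and x₁ + 1 but bridges nothing.
deletionCost-noBridge : ∀ x₁ rest → indicator (suc x₁ ≟ 1) ≡ 0 →
  adjacencies (suc (suc x₁)) (map suc rest ++ [ suc (length (x₁ ∷ 0 ∷ suc x₁ ∷ rest)) ]) ≡ 0 →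
  x₁ ≢ 1 → deletionCost [ x₁ ] 0 (suc x₁ ∷ rest) ≤ 1
deletionCost-noBridge x₁ rest no01 noTail x₁≢1 = ≤-reflexive (cong₂ _+_ oneAdjacency noBridge)
  where
  T = map suc rest ++ [ suc (length (x₁ ∷ 0 ∷ suc x₁ ∷ rest)) ]
  oneAdjacency : adjacencies 0 (suc x₁ ∷ suc (suc x₁) ∷ T) ≡ 1
  oneAdjacency rewrite no01 | noTail | indicator-yes refl (suc (suc x₁) ≟ suc (suc x₁)) = refl
  noneBelow1 : All (λ c → suc c ≢ 1) (suc x₁ ∷ suc (suc x₁) ∷ T)
  noneBelow1 = (λ ()) ∷ (λ ()) ∷ All.++⁺ (All.map⁺ (All.universal (λ _ ()) rest)) ((λ ()) ∷ [])
  noBridge : bridges 1 0 (suc x₁ ∷ suc (suc x₁) ∷ T) ≡ 0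
  noBridge rewrite indicator-no (x₁≢1 ∘ suc-injective ∘ proj₂) ((1 ≟ 1) ×-dec (suc x₁ ≟ 2)) =
    bridges≡0 1 (suc x₁) (suc (suc x₁) ∷ T) noneBelow1

CheapDeletion : List ℕ → Set
CheapDeletion σ = Σ[ L ∈ List ℕ ] Σ[ x ∈ ℕ ] Σ[ R ∈ List ℕ ] σ ≡ L ++ x ∷ R × deletionCost L x R ≤ 1

adjacencyFree-cheapDeletion : ∀ x₁ x₂ x₃ rest → IsPerm (x₁ ∷ x₂ ∷ x₃ ∷ rest) →
  #adj (x₁ ∷ x₂ ∷ x₃ ∷ rest) ≡ 0 → CheapDeletion (x₁ ∷ x₂ ∷ x₃ ∷ rest)
adjacencyFree-cheapDeletion x₁ x₂ x₃ rest p free = choose x₂ refl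
  where
  T = map suc rest ++ [ suc (length (x₁ ∷ x₂ ∷ x₃ ∷ rest)) ]
  tail₁ = m+n≡0⇒n≡0 (indicator (suc x₁ ≟ 1)) free
  tail₂ = m+n≡0⇒n≡0 (indicator (suc x₂ ≟ suc (suc x₁))) tail₁
  no01 : indicator (suc x₁ ≟ 1) ≡ 0
  no01 = m+n≡0⇒m≡0 _ free
  no23 : indicator (suc x₃ ≟ suc (suc x₂)) ≡ 0
  no23 = m+n≡0⇒m≡0 _ tail₂
  noTail : adjacencies (suc x₃) T ≡ 0
  noTail = m+n≡0⇒n≡0 (indicator (suc x₃ ≟ suc (suc x₂))) tail₂
  choose : ∀ y₂ → x₂ ≡ y₂ → CheapDeletion (x₁ ∷ x₂ ∷ x₃ ∷ rest)
  choose (suc y) refl = [] , x₁ , x₂ ∷ x₃ ∷ rest , refl ,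
    deletionCost-noAdjacency [] x₁ (x₂ ∷ x₃ ∷ rest) p (cong₂ _+_ no23 noTail)
  choose zero refl with x₃ ≟ suc x₁
  ... | no x₃≢1+x₁ = [ x₁ ] , 0 , x₃ ∷ rest , refl ,
    deletionCost-noAdjacency [ x₁ ] 0 (x₃ ∷ rest) p
      (cong₂ _+_ no01 (cong₂ _+_ (indicator-no (x₃≢1+x₁ ∘ suc-injective) (suc x₃ ≟ suc (suc x₁))) noTail))
  ... | yes refl with adjacencies 1 T ≟ 0
  ...   | yes noTail′ = x₁ ∷ 0 ∷ [] , x₃ , rest , refl ,
    deletionCost-noAdjacency (x₁ ∷ 0 ∷ []) x₃ rest p (cong₂ _+_ no01 noTail′)
  ...   | no nextIs1 = [ x₁ ] , 0 , x₃ ∷ rest , refl , cost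
    where
    x₁∉rest : All (x₁ ≢_) rest
    x₁∉rest = All.tail (All.tail (AllPairs.head (isPerm⇒unique p)))
    restStartsWith1 : ∃ λ rest′ → rest ≡ 1 ∷ rest′
    restStartsWith1 = frameTail-head rest (proj₂ (adjacencies-head T nextIs1 noTail)) (λ ())
    x₁≢1 : x₁ ≢ 1
    x₁≢1 = All.head (subst (All (x₁ ≢_)) (proj₂ restStartsWith1) x₁∉rest)
    cost : deletionCost [ x₁ ] 0 (x₃ ∷ rest) ≤ 1
    cost = deletionCost-noBridge x₁ rest no01 noTail x₁≢1

mainTheorem3 : (k : ℕ) → 1 ≤ k → (σ : List ℕ) → InBasis k σ → length σ ≤ 3 * k + 1
mainTheorem3 k k≥1 []           _ = z≤n
mainTheorem3 k k≥1 (_ ∷ [])     _ = m≤n+m 1 (3 * k)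
mainTheorem3 k k≥1 (_ ∷ _ ∷ []) _ = +-monoˡ-≤ 1 (≤-trans k≥1 (m≤m+n k (2 * k)))
mainTheorem3 k _ σ@(x₁ ∷ x₂ ∷ x₃ ∷ rest) b
  with adjacencyFree-cheapDeletion x₁ x₂ x₃ rest (proj₁ b) (basis-adjacencyFree σ b)
... | L , x , R , σ≡ , cost≤1 =
  subst (λ τ → length τ ≤ 3 * k + 1) (sym σ≡) (basis-length≤ L x R (subst (InBasis k) σ≡ b) cost≤1)
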